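{- Let $(U,\varphi)$ be a finite standard closure space with closed sets $\mathcal{C}$, let $x\in U$ and $A\subseteq U$. Then $A$ is an $E$-generator of $x$ if and only if: (1) $A$ is a $\varphi^b$-minimal spanning set of $\varphi(A)$; (2) $x\in\varphi(A)$ and $x\notin\varphi^b(A)$; and (3) for every $C\in\mathcal{C}$ with $C\subsetneq\varphi(A)$ and $x\in C$, $x$ is prime in $(\downarrow C,\subseteq)$.
   Context: $(U,\varphi)$: finite set with closure operator; closed sets $\mathcal{C}$; standard means $\varphi(\{x\})\setminus\{x\}$ is closed for all $x$. $\varphi^b(X)=\bigcup_{y\in X}\varphi(\{y\})$. A spanning set of $C\in\mathcal{C}$ is $X$ with $\varphi(X)=C$; it is $\varphi^b$-minimal if no $B$ with $\varphi^b(B)\subsetneq\varphi^b(X)$ spans $C$. $\downarrow C=\{C'\in\mathcal{C}: C'\subseteq C\}$; $x$ is prime in $(\downarrow C,\subseteq)$ if for all $C_1,C_2\in\downarrow C$, $x\in\varphi(C_1\cup C_2)$ implies $x\in C_1$ or $x\in C_2$. $D$-generator of $x$: $A$ with $x\in\varphi(A)$, $x\notin\varphi^b(A)$, and $x\notin\varphi(B)$ for all $B$ with $\varphi^b(B)\subsetneq\varphi^b(A)$. $E$-generator of $x$: a $D$-generator $A$ of $x$ with $\varphi(A)$ inclusion-minimal in $\{\varphi(B): B \text{ a } D\text{ -generator of } x\}$. -}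

module Defs where

open import Data.Nat using (ℕ)
open import Data.Fin using (Fin)
open import Data.Fin.Subset
open import Data.Bool using (if_then_else_)
open import Data.Vec using (lookup)
open import Data.List using (map)
open import Data.List.Base using (allFin)
open import Data.Product using (_×_)
open import Data.Sum using (_⊎_)
open import Relation.Nullary using (¬_)
open import Relation.Binary.PropositionalEquality using (_≡_)

record ClosureSpace (n : ℕ) : Set where
  field
    φ          : Subset n → Subset n
    extensive  : ∀ X → X ⊆ φ X
    monotone   : ∀ X Y → X ⊆ Y → φ X ⊆ φ Y
    idempotent : ∀ X → φ (φ X) ≡ φ X

module _ {n : ℕ} (S : ClosureSpace n) where
  open ClosureSpace S

  Closed : Subset n → Set
  Closed C = φ C ≡ C

  Standard : Set
  Standard = ∀ (x : Fin n) → Closed (φ ⁅ x ⁆ - x)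

  φb : Subset n → Subset n
  φb X = ⋃ (map (λ y → if lookup X y then φ ⁅ y ⁆ else ⊥) (allFin n))

  Spans : Subset n → Subset n → Set
  Spans X C = φ X ≡ C

  MinSpanning : Subset n → Subset n → Set
  MinSpanning X C = Spans X C × (∀ B → φb B ⊂ φb X → ¬ Spans B C)

  PrimeIn : Fin n → Subset n → Set
  PrimeIn x C = ∀ C₁ C₂ → Closed C₁ → C₁ ⊆ C → Closed C₂ → C₂ ⊆ C →
                x ∈ φ (C₁ ∪ C₂) → x ∈ C₁ ⊎ x ∈ C₂

  DGen : Fin n → Subset n → Set
  DGen x A = x ∈ φ A × x ∉ φb A × (∀ B → φb B ⊂ φb A → x ∉ φ B)

  EGen : Fin n → Subset n → Set
  EGen x A = DGen x A × (∀ B → DGen x B → ¬ (φ B ⊂ φ A))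

{-# OPTIONS --safe #-}
module Submission where

-- If A is an E-generator and x ∈ φ(C₁ ∪ C₂) for closed C₁, C₂ ⊆ C ⊂ φ A with x in
-- neither, then x ∉ φb(C₁ ∪ C₂) ⊆ C₁ ∪ C₂, and descending along φb below C₁ ∪ C₂
-- yields a D-generator of x whose closure lies in C ⊊ φ A, against E-minimality.
-- Conversely, φ B = φ(⋃_{y ∈ B} φ{y}), so primality of x in ↓φ B puts x into some
-- φ{y} with y ∈ B, or into φ ∅, which would force φ A = φ ∅. Hence x ∈ φ B ⊊ φ A
-- implies x ∈ φb B; this excludes D-generators with smaller closure and, since A is
-- a φb-minimal spanning set, any B with φb B ⊊ φb A and x ∈ φ B.

open import Defs
open import Data.Nat using (ℕ; _<_)
open import Data.Nat.Induction using (<-wellFounded)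
open import Data.Fin using (Fin)
open import Data.Fin.Subset
  using (Subset; _∈_; _∉_; _⊆_; _⊂_; _∪_; ⋃; ⁅_⁆; ∣_∣) renaming (⊥ to ∅)
open import Data.Fin.Subset.Properties
open import Data.Fin.Properties using (any?)
open import Data.Bool using (true; false; if_then_else_)
open import Data.Vec using (lookup)
open import Data.Vec.Properties using ([]=⇒lookup; lookup⇒[]=)
open import Data.List using (List; []; _∷_; map; allFin)
open import Data.List.Relation.Unary.Any using (Any; here; there; satisfied)
open import Data.List.Relation.Unary.Any.Properties using (map⁺; map⁻)
open import Data.List.Membership.Propositional using (lose)
open import Data.List.Membership.Propositional.Properties using (∈-allFin)
open import Data.Product using (_×_; ∃; _,_; proj₁)
open import Data.Sum using (_⊎_; inj₁; inj₂; [_,_]′; map₂)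
open import Data.Empty using (⊥-elim)
open import Function using (_∘_)
open import Function.Bundles using (_⇔_; mk⇔)
open import Induction.WellFounded using (Acc; acc)
open import Relation.Nullary using (¬_; yes; no; ¬?)
open import Relation.Nullary.Decidable using (_×-dec_)
open import Relation.Binary.PropositionalEquality using (_≢_; refl; sym; subst)

⊆∧≢⇒⊂ : ∀ {n} {p q : Subset n} → p ⊆ q → p ≢ q → p ⊂ q
⊆∧≢⇒⊂ {p = p} {q} p⊆q p≢q with any? (λ z → (z ∈? q) ×-dec ¬? (z ∈? p))
... | yes (z , z∈q , z∉p) = p⊆q , z , z∈q , z∉p
... | no ∄z = ⊥-elim (p≢q (⊆-antisym p⊆q q⊆p))
  where
  q⊆p : q ⊆ p
  q⊆p {z} z∈q with z ∈? p
  ... | yes z∈p = z∈p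
  ... | no z∉p = ⊥-elim (∄z (z , z∈q , z∉p))

∈⋃⁺ : ∀ {n} {z : Fin n} {Ds : List (Subset n)} → Any (z ∈_) Ds → z ∈ ⋃ Ds
∈⋃⁺ (here z∈D) = x∈p∪q⁺ (inj₁ z∈D)
∈⋃⁺ (there z∈Ds) = x∈p∪q⁺ (inj₂ (∈⋃⁺ z∈Ds))

∈⋃⁻ : ∀ {n} {z : Fin n} (Ds : List (Subset n)) → z ∈ ⋃ Ds → Any (z ∈_) Ds
∈⋃⁻ [] z∈∅ = ⊥-elim (∉⊥ z∈∅)
∈⋃⁻ (D ∷ Ds) z∈⋃ = [ here , there ∘ ∈⋃⁻ Ds ]′ (x∈p∪q⁻ D (⋃ Ds) z∈⋃)

x∈p⇒⁅x⁆⊆p : ∀ {n} {x : Fin n} {p : Subset n} → x ∈ p → ⁅ x ⁆ ⊆ p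
x∈p⇒⁅x⁆⊆p {x = x} {p} x∈p z∈⁅x⁆ = subst (_∈ p) (sym (x∈⁅y⁆⇒x≡y x z∈⁅x⁆)) x∈p

module _ {n : ℕ} (S : ClosureSpace n) where
  open ClosureSpace S

  φ-mono : ∀ {X Y} → X ⊆ Y → φ X ⊆ φ Y
  φ-mono = monotone _ _

  φ-idem : ∀ {X} → φ (φ X) ⊆ φ X
  φ-idem {X} = subst (_ ∈_) (idempotent X)

  φ-least : ∀ {X C} → Closed S C → X ⊆ C → φ X ⊆ C
  φ-least closed X⊆C = subst (_ ∈_) closed ∘ φ-mono X⊆C

  φ-∅-least : ∀ X → φ ∅ ⊆ φ X
  φ-∅-least X = φ-mono (⊆-min X)

  φ-∪ : ∀ {X Y} → φ (X ∪ Y) ⊆ φ (φ X ∪ φ Y)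
  φ-∪ {X} {Y} = φ-mono (x∈p∪q⁺ ∘ [ inj₁ ∘ extensive X , inj₂ ∘ extensive Y ]′ ∘ x∈p∪q⁻ X Y)

  -- φb S X is definitionally ⋃ (map (φb-part X) (allFin n)).
  φb-part : Subset n → Fin n → Subset n
  φb-part X y = if lookup X y then φ ⁅ y ⁆ else ∅

  φb-part-cases : ∀ {X y} (P : Subset n → Set) → P (φb-part X y) → P ∅ ⊎ (y ∈ X × P (φ ⁅ y ⁆))
  φb-part-cases {X} {y} P p with lookup X y in eq
  ... | true = inj₂ (lookup⇒[]= y X eq , p)
  ... | false = inj₁ p

  ∈φb⁺ : ∀ {X y z} → y ∈ X → z ∈ φ ⁅ y ⁆ → z ∈ φb S X
  ∈φb⁺ {X} {y} {z} y∈X z∈φy = ∈⋃⁺ (map⁺ (lose (∈-allFin y) z∈part))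
    where
    z∈part : z ∈ φb-part X y
    z∈part rewrite []=⇒lookup y∈X = z∈φy

  ∈φb⁻ : ∀ {X z} → z ∈ φb S X → ∃ λ y → y ∈ X × z ∈ φ ⁅ y ⁆
  ∈φb⁻ {X} {z} z∈φbX with satisfied (map⁻ (∈⋃⁻ (map (φb-part X) (allFin n)) z∈φbX))
  ... | y , z∈part with φb-part-cases (z ∈_) z∈part
  ...   | inj₁ z∈∅ = ⊥-elim (∉⊥ z∈∅)
  ...   | inj₂ (y∈X , z∈φy) = y , y∈X , z∈φy

  φb-least : ∀ {X Y} → (∀ {y} → y ∈ X → φ ⁅ y ⁆ ⊆ Y) → φb S X ⊆ Y
  φb-least φy⊆Y z∈φbX with ∈φb⁻ z∈φbX
  ... | y , y∈X , z∈φy = φy⊆Y y∈X z∈φy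

  φb⊆φ : ∀ X → φb S X ⊆ φ X
  φb⊆φ X = φb-least (φ-mono ∘ x∈p⇒⁅x⁆⊆p)

  ⊆φb : ∀ X → X ⊆ φb S X
  ⊆φb X {y} y∈X = ∈φb⁺ y∈X (extensive ⁅ y ⁆ (x∈⁅x⁆ y))

  φ-φb⊆φ : ∀ X → φ (φb S X) ⊆ φ X
  φ-φb⊆φ X = φ-idem ∘ φ-mono (φb⊆φ X)

  φ⊆φ-φb : ∀ X → φ X ⊆ φ (φb S X)
  φ⊆φ-φb X = φ-mono (⊆φb X)

  φb-∪-closed : ∀ {C₁ C₂} → Closed S C₁ → Closed S C₂ → φb S (C₁ ∪ C₂) ⊆ C₁ ∪ C₂
  φb-∪-closed {C₁} {C₂} closed₁ closed₂ = φb-least λ y∈C₁∪C₂ →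
    [ (λ y∈C₁ → p⊆p∪q C₂ ∘ φ-least closed₁ (x∈p⇒⁅x⁆⊆p y∈C₁))
    , (λ y∈C₂ → q⊆p∪q C₁ C₂ ∘ φ-least closed₂ (x∈p⇒⁅x⁆⊆p y∈C₂))
    ]′ (x∈p∪q⁻ C₁ C₂ y∈C₁∪C₂)

  prime-⋃ : ∀ {x C} → PrimeIn S x C → (Ds : List (Subset n)) → φ (⋃ Ds) ⊆ C →
            x ∈ φ (⋃ Ds) → x ∈ φ ∅ ⊎ Any (λ D → x ∈ φ D) Ds
  prime-⋃ prime [] _ x∈φ∅ = inj₁ x∈φ∅
  prime-⋃ prime (D ∷ Ds) φ⋃⊆C x∈φ⋃
    with prime (φ D) (φ (⋃ Ds)) (idempotent D) (φ⋃⊆C ∘ φ-mono (p⊆p∪q (⋃ Ds)))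
               (idempotent (⋃ Ds)) (φ⋃⊆C ∘ φ-mono (q⊆p∪q D (⋃ Ds))) (φ-∪ x∈φ⋃)
  ... | inj₁ x∈φD = inj₂ (here x∈φD)
  ... | inj₂ x∈φ⋃Ds = map₂ there (prime-⋃ prime Ds (φ⋃⊆C ∘ φ-mono (q⊆p∪q D (⋃ Ds))) x∈φ⋃Ds)

  prime-φb : ∀ {x C X} → PrimeIn S x C → φ X ⊆ C → x ∈ φ X → x ∈ φ ∅ ⊎ x ∈ φb S X
  prime-φb {x} {X = X} prime φX⊆C x∈φX
    with prime-⋃ prime (map (φb-part X) (allFin n)) (φX⊆C ∘ φ-φb⊆φ X) (φ⊆φ-φb X x∈φX)
  ... | inj₁ x∈φ∅ = inj₁ x∈φ∅
  ... | inj₂ x∈φpart with satisfied (map⁻ x∈φpart)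
  ...   | y , x∈φpartʸ with φb-part-cases {X} (λ D → x ∈ φ D) x∈φpartʸ
  ...     | inj₁ x∈φ∅ = inj₁ x∈φ∅
  ...     | inj₂ (y∈X , x∈φφy) = inj₂ (∈φb⁺ y∈X (φ-idem x∈φφy))

  -- Constructively phrased existence of a D-generator B′ of x with φb B′ ⊆ φb B.
  DGen-below : ∀ {x B} → x ∈ φ B → x ∉ φb S B → ¬ (∀ B′ → φb S B′ ⊆ φb S B → ¬ DGen S x B′)
  DGen-below {x} {B} = descend B (<-wellFounded ∣ φb S B ∣)
    where
    descend : ∀ B → Acc _<_ ∣ φb S B ∣ →
              x ∈ φ B → x ∉ φb S B → ¬ (∀ B′ → φb S B′ ⊆ φb S B → ¬ DGen S x B′)
    descend B (acc rec) x∈φB x∉φbB none = none B ⊆-refl (x∈φB , x∉φbB , smaller)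
      where
      smaller : ∀ B′ → φb S B′ ⊂ φb S B → x ∉ φ B′
      smaller B′ φbB′⊂φbB x∈φB′ =
        descend B′ (rec (p⊂q⇒∣p∣<∣q∣ φbB′⊂φbB)) x∈φB′ (x∉φbB ∘ proj₁ φbB′⊂φbB)
                (λ B″ φbB″⊆φbB′ → none B″ (proj₁ φbB′⊂φbB ∘ φbB″⊆φbB′))

  DGen⇒MinSpanning : ∀ {x A} → DGen S x A → MinSpanning S A (φ A)
  DGen⇒MinSpanning (x∈φA , _ , minimal) =
    refl , λ B φbB⊂φbA φB≡φA → minimal B φbB⊂φbA (subst (_ ∈_) (sym φB≡φA) x∈φA)

  EGen⇒PrimeIn : ∀ {x A C} → EGen S x A → Closed S C → C ⊂ φ A → PrimeIn S x C
  EGen⇒PrimeIn {x} {C = C} (_ , minimal) closed C⊂φA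
               C₁ C₂ closed₁ C₁⊆C closed₂ C₂⊆C x∈φC₁∪C₂
    with x ∈? C₁ | x ∈? C₂
  ... | yes x∈C₁ | _ = inj₁ x∈C₁
  ... | no _ | yes x∈C₂ = inj₂ x∈C₂
  ... | no x∉C₁ | no x∉C₂ = ⊥-elim (DGen-below x∈φC₁∪C₂ x∉φbC₁∪C₂ noneBelow)
    where
    φbC₁∪C₂⊆C₁∪C₂ : φb S (C₁ ∪ C₂) ⊆ C₁ ∪ C₂
    φbC₁∪C₂⊆C₁∪C₂ = φb-∪-closed closed₁ closed₂

    x∉φbC₁∪C₂ : x ∉ φb S (C₁ ∪ C₂)
    x∉φbC₁∪C₂ = [ x∉C₁ , x∉C₂ ]′ ∘ x∈p∪q⁻ C₁ C₂ ∘ φbC₁∪C₂⊆C₁∪C₂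

    noneBelow : ∀ B → φb S B ⊆ φb S (C₁ ∪ C₂) → ¬ DGen S x B
    noneBelow B φbB⊆ dgen = minimal B dgen (⊆-⊂-trans φB⊆C C⊂φA)
      where
      φB⊆C : φ B ⊆ C
      φB⊆C = φ-least closed ([ C₁⊆C , C₂⊆C ]′ ∘ x∈p∪q⁻ C₁ C₂ ∘ φbC₁∪C₂⊆C₁∪C₂ ∘ φbB⊆)
           ∘ φ⊆φ-φb B

  MinSpanning⇒φ⊂φ : ∀ {A B} → MinSpanning S A (φ A) → φb S B ⊂ φb S A → φ B ⊂ φ A
  MinSpanning⇒φ⊂φ {A} {B} (_ , minimal) φbB⊂φbA =
    ⊆∧≢⇒⊂ (φ-φb⊆φ A ∘ φ-mono (proj₁ φbB⊂φbA) ∘ φ⊆φ-φb B) (minimal B φbB⊂φbA)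

  EGenConditions : Fin n → Subset n → Set
  EGenConditions x A = MinSpanning S A (φ A)
                     × (x ∈ φ A × x ∉ φb S A)
                     × (∀ C → Closed S C → C ⊂ φ A → x ∈ C → PrimeIn S x C)

  ∈φ∅⇒φ⊆φ∅ : ∀ {x A} → x ∈ φ ∅ → x ∉ φb S A → φ A ⊆ φ ∅
  ∈φ∅⇒φ⊆φ∅ x∈φ∅ x∉φbA =
    φ-mono λ {y} y∈A → ⊥-elim (x∉φbA (∈φb⁺ y∈A (φ-∅-least ⁅ y ⁆ x∈φ∅)))

  EGenConditions⇒∈φb : ∀ {x A B} → EGenConditions x A → φ B ⊂ φ A → x ∈ φ B → x ∈ φb S B
  EGenConditions⇒∈φb {B = B} (_ , (_ , x∉φbA) , prime) φB⊂φA x∈φB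
    with prime-φb (prime (φ B) (idempotent B) φB⊂φA x∈φB) ⊆-refl x∈φB
  ... | inj₂ x∈φbB = x∈φbB
  ... | inj₁ x∈φ∅ =
    ⊥-elim (⊂-irref refl (⊆-⊂-trans (φ-∅-least B ∘ ∈φ∅⇒φ⊆φ∅ x∈φ∅ x∉φbA) φB⊂φA))

lemma1 : ∀ {n : ℕ} (S : ClosureSpace n) → Standard S → (x : Fin n) (A : Subset n) →
           EGen S x A ⇔
             ( MinSpanning S A (ClosureSpace.φ S A)
             × (x ∈ ClosureSpace.φ S A × x ∉ φb S A)
             × (∀ C → Closed S C → C ⊂ ClosureSpace.φ S A → x ∈ C → PrimeIn S x C) )
lemma1 S _ x A = mk⇔ forward backward
  where
  open ClosureSpace S

  forward : EGen S x A → EGenConditions S x A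
  forward egen@(dgen@(x∈φA , x∉φbA , _) , _) =
    DGen⇒MinSpanning S dgen , (x∈φA , x∉φbA) , λ _ closed C⊂φA _ → EGen⇒PrimeIn S egen closed C⊂φA

  backward : EGenConditions S x A → EGen S x A
  backward conditions@(spanning , (x∈φA , x∉φbA) , _) = (x∈φA , x∉φbA , dgenMinimal) , egenMinimal
    where
    dgenMinimal : ∀ B → φb S B ⊂ φb S A → x ∉ φ B
    dgenMinimal B φbB⊂φbA =
      x∉φbA ∘ proj₁ φbB⊂φbA ∘ EGenConditions⇒∈φb S conditions (MinSpanning⇒φ⊂φ S spanning φbB⊂φbA)

    egenMinimal : ∀ B → DGen S x B → ¬ (φ B ⊂ φ A)
    egenMinimal B (x∈φB , x∉φbB , _) φB⊂φA = x∉φbB (EGenConditions⇒∈φb S conditions φB⊂φA x∈φB)
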